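{- Let $M=(E,\mathcal L)$ be a nearly finitary matroid that is not $n$-nearly finitary for any natural number $n$, and let $S\subseteq E$ be finite. Then $M-S=(E\setminus S,\ \mathcal L\cap 2^{E\setminus S})$ is a nearly finitary matroid that is not $n$-nearly finitary for any natural number $n$.
   Context: A matroid is a pair $M=(E,\mathcal L)$, where $E$ is a possibly infinite set and $\mathcal L\subseteq 2^E$ satisfies: (I1) $\emptyset\in\mathcal L$; (I2) if $B\in\mathcal L$ and $A\subseteq B$ then $A\in\mathcal L$; (I3) if $B$ is a maximal element of $\mathcal L$ and $A\in\mathcal L$ is not maximal, then there is $b\in B\setminus A$ with $A\cup\{b\}\in\mathcal L$; (I4) if $A\in\mathcal L$ and $A\subseteq X\subseteq E$, then $\{S\in\mathcal L: A\subseteq S\subseteq X\}$ has a maximal element. Maximal independent sets are bases. The finitarization is $M^{\mathrm{fin}}=(E,\mathcal L^{\mathrm{fin}})$, where $S\in\mathcal L^{\mathrm{fin}}$ iff every finite subset of $S$ is in $\mathcal L$. $M$ is nearly finitary if whenever $F$ is a base of $M^{\mathrm{fin}}$, $B$ is a base of $M$ and $B\subseteq F$, the set $F\setminus B$ is finite; $M$ is $n$-nearly finitary if in this situation always $|F\setminus B|\le n$. -}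

module Defs where

open import Level using (Level; 0ℓ; _⊔_; suc)
open import Data.Nat using (ℕ; _≤_)
open import Data.List using (List; length)
open import Data.List.Membership.Propositional using (_∈_)
open import Data.Product using (Σ; _×_; ∃; ∃-syntax)
open import Data.Sum using (_⊎_)
open import Data.Empty using (⊥)
open import Relation.Nullary using (¬_)
open import Relation.Binary.PropositionalEquality using (_≡_)

Subset : Set → Set₁
Subset U = U → Set

module _ {U : Set} where

  _⊆_ : Subset U → Subset U → Set
  A ⊆ B = ∀ x → A x → B x

  ∅ : Subset U
  ∅ _ = ⊥

  _∪_ : Subset U → Subset U → Subset U
  (A ∪ B) x = A x ⊎ B x

  ｛_｝ : U → Subset U
  ｛ b ｝ x = x ≡ b

  _∖_ : Subset U → Subset U → Subset U
  (A ∖ B) x = A x × ¬ B x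

  Finite : Subset U → Set
  Finite A = ∃[ xs ] (∀ x → A x → x ∈ xs)

  AtMost : ℕ → Subset U → Set
  AtMost n A = ∃[ xs ] (length xs ≤ n × (∀ x → A x → x ∈ xs))

  Maximal : {ℓ : Level} → (Subset U → Set ℓ) → Subset U → Set (suc 0ℓ ⊔ ℓ)
  Maximal 𝓕 B = 𝓕 B × (∀ C → 𝓕 C → B ⊆ C → C ⊆ B)

  record IsMatroid (E : Subset U) (L : Subset U → Set) : Set₁ where
    field
      indep⊆E : ∀ A → L A → A ⊆ E
      I1 : L ∅
      I2 : ∀ A B → L B → A ⊆ B → L A
      I3 : ∀ A B → Maximal L B → L A → ¬ Maximal L A →
           ∃[ b ] (B b × ¬ A b × L (A ∪ ｛ b ｝))
      I4 : ∀ A X → L A → A ⊆ X → X ⊆ E →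
           ∃[ S ] Maximal (λ S → L S × A ⊆ S × S ⊆ X) S

  -- Independent sets of the finitarization: every finite subset is in L.
  FinIndep : (Subset U → Set) → Subset U → Set₁
  FinIndep L S = ∀ T → Finite T → T ⊆ S → L T

  NearlyFinitary : (Subset U → Set) → Set₁
  NearlyFinitary L = ∀ F B → Maximal (FinIndep L) F → Maximal L B → B ⊆ F →
                     Finite (F ∖ B)

  NNearlyFinitary : ℕ → (Subset U → Set) → Set₁
  NNearlyFinitary n L = ∀ F B → Maximal (FinIndep L) F → Maximal L B → B ⊆ F →
                        AtMost n (F ∖ B)

  DelGround : Subset U → Subset U → Subset U
  DelGround E S = E ∖ S

  DelIndep : (Subset U → Set) → Subset U → Subset U → Set
  DelIndep L S A = L A × (A ⊆ (λ x → ¬ S x))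

module Submission where

-- All notions are invariant under extensional equality of the ground set and of the
-- independent sets, so by induction over a list enumerating S it suffices to delete
-- a single element s.  Deletion preserves the matroid axioms because matroids
-- restrict well: a maximal independent subset of X augments every independent subset
-- of X that can be augmented inside X ('augmentWithin').  From this follows weak
-- circuit elimination, and from that the exchange step of the finitarization: if T
-- is a circuit in F ∪ {y} for a finitary base F, then F ∪ {y} − f is again a
-- finitary base for every f ∈ T other than y ('finExchange').  The central lemma
-- 'absorb' uses it to turn a set that is a finitary base up to one element y into a
-- finitary base containing a prescribed independent set while losing at most one
-- point.  Comparing bases of M − s and (M − s)^fin with those of M and M^fin this way
-- shows that M − s is nearly finitary when M is, and that M would be (3 + n)-nearly
-- finitary if M − s were n-nearly finitary.

open import Defs
open import Level using (Level; 0ℓ; suc; lift; lower)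
open import Data.Nat using (ℕ; _+_; s≤s)
open import Data.List using (List; []; _∷_; _++_; filter)
open import Data.List.Membership.Propositional using (_∈_)
open import Data.List.Membership.Propositional.Properties using (∈-filter⁺; ∈-filter⁻; ∈-++⁺ˡ; ∈-++⁺ʳ)
open import Data.List.Relation.Unary.Any using (here; there)
open import Data.Product using (∃; _×_; _,_; proj₁; proj₂)
open import Data.Sum using (_⊎_; inj₁; inj₂; [_,_])
open import Data.Empty using (⊥; ⊥-elim)
open import Relation.Nullary using (¬_; Dec; yes; no)
open import Relation.Nullary.Decidable using (map′; decidable-stable)
open import Relation.Binary.PropositionalEquality using (_≡_; refl; sym; trans)
open import Axiom.ExcludedMiddle using (ExcludedMiddle)

module Classical (em : ExcludedMiddle (suc 0ℓ)) {U : Set} where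

  dec : (P : Set) → Dec P
  dec P = map′ lower lift em

  dne : {P : Set} → ¬ ¬ P → P
  dne = decidable-stable (dec _)

  dne₁ : {P : Set₁} → ¬ ¬ P → P
  dne₁ = decidable-stable em

  ¬⊆⇒witness : {A B : Subset U} → ¬ (A ⊆ B) → ∃ λ x → A x × ¬ B x
  ¬⊆⇒witness ¬A⊆B = dne λ none → ¬A⊆B (λ x Ax → dne λ ¬Bx → none (x , Ax , ¬Bx))

  _−_ : Subset U → U → Subset U
  (A − x) y = A y × ¬ y ≡ x

  ⊆-trans : {A B C : Subset U} → A ⊆ B → B ⊆ C → A ⊆ C
  ⊆-trans A⊆B B⊆C x Ax = B⊆C x (A⊆B x Ax)

  ∪-lub : {A B C : Subset U} → A ⊆ C → B ⊆ C → (A ∪ B) ⊆ C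
  ∪-lub A⊆C B⊆C x (inj₁ Ax) = A⊆C x Ax
  ∪-lub A⊆C B⊆C x (inj₂ Bx) = B⊆C x Bx

  ∪-mono : {A B : Subset U} {y : U} → A ⊆ B → (A ∪ ｛ y ｝) ⊆ (B ∪ ｛ y ｝)
  ∪-mono A⊆B = ∪-lub (λ x Ax → inj₁ (A⊆B x Ax)) (λ _ → inj₂)

  ∪｛｝⊆ : {A C : Subset U} {x : U} → A ⊆ C → C x → (A ∪ ｛ x ｝) ⊆ C
  ∪｛｝⊆ A⊆C Cx = ∪-lub A⊆C λ { _ refl → Cx }

  −⊆ : {A B : Subset U} {y : U} → A ⊆ (B ∪ ｛ y ｝) → (A − y) ⊆ B
  −⊆ A⊆ x (Ax , x≢y) with A⊆ x Ax
  ... | inj₁ Bx = Bx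
  ... | inj₂ x≡y = ⊥-elim (x≢y x≡y)

  finite-⊆ : {A B : Subset U} → A ⊆ B → Finite B → Finite A
  finite-⊆ A⊆B (xs , cover) = xs , λ x Ax → cover x (A⊆B x Ax)

  finite-｛｝ : {x : U} → Finite ｛ x ｝
  finite-｛｝ {x} = x ∷ [] , λ { _ refl → here refl }

  finite-∪ : {A B : Subset U} → Finite A → Finite B → Finite (A ∪ B)
  finite-∪ (xs , coverA) (ys , coverB) =
    xs ++ ys , ∪-lub (λ x Ax → ∈-++⁺ˡ (coverA x Ax)) (λ x Bx → ∈-++⁺ʳ xs (coverB x Bx))

  finite-∪｛｝ : {A : Subset U} {y : U} → Finite A → Finite (A ∪ ｛ y ｝)
  finite-∪｛｝ {y = y} (xs , cover) = y ∷ xs , ∪-lub (λ x Ax → there (cover x Ax)) λ { _ refl → here refl }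

  atMost-⊆ : {n : ℕ} {A B : Subset U} → A ⊆ B → AtMost n B → AtMost n A
  atMost-⊆ A⊆B (xs , len , cover) = xs , len , λ x Ax → cover x (A⊆B x Ax)

  atMost-∪｛｝ : {n : ℕ} {A : Subset U} {y : U} → AtMost n A → AtMost (1 + n) (A ∪ ｛ y ｝)
  atMost-∪｛｝ {y = y} (xs , len , cover) =
    y ∷ xs , s≤s len , ∪-lub (λ x Ax → there (cover x Ax)) λ { _ refl → here refl }

  listing : {S : Subset U} → Finite S → ∃ λ xs → S ⊆ (_∈ xs) × (_∈ xs) ⊆ S
  listing {S} (xs , cover) =
    filter S? xs , (λ x Sx → ∈-filter⁺ S? (cover x Sx) Sx) , (λ x x∈ → proj₂ (∈-filter⁻ S? {xs = xs} x∈))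
    where
    S? : (x : U) → Dec (S x)
    S? x = dec (S x)

  maximal-restrict : {ℓ₁ ℓ₂ : Level} {P : Subset U → Set ℓ₁} {Q : Subset U → Set ℓ₂} {B : Subset U} →
                     (∀ A → Q A → P A) → Q B → Maximal P B → Maximal Q B
  maximal-restrict Q⊆P QB (_ , maxB) = QB , λ C QC B⊆C → maxB C (Q⊆P C QC) B⊆C

  maximal-resp : {ℓ₁ ℓ₂ : Level} {P : Subset U → Set ℓ₁} {Q : Subset U → Set ℓ₂} {B : Subset U} →
                 (∀ A → P A → Q A) → (∀ A → Q A → P A) → Maximal P B → Maximal Q B
  maximal-resp P⊆Q Q⊆P maxB = maximal-restrict Q⊆P (P⊆Q _ (proj₁ maxB)) maxB

  maximal-cannot-grow : {ℓ : Level} {P : Subset U → Set ℓ} {B : Subset U} {x : U} →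
                        Maximal P B → ¬ B x → ¬ P (B ∪ ｛ x ｝)
  maximal-cannot-grow (_ , maxB) ¬Bx P[B+x] = ¬Bx (maxB _ P[B+x] (λ _ → inj₁) _ (inj₂ refl))

  not-maximal⇒larger : {P : Subset U → Set} {A : Subset U} → P A → ¬ Maximal P A →
                       ∃ λ C → P C × A ⊆ C × ∃ λ c → C c × ¬ A c
  not-maximal⇒larger PA ¬maxA = dne₁ λ none → ¬maxA (PA , λ C PC A⊆C x Cx →
    dne λ ¬Ax → none (C , PC , A⊆C , x , Cx , ¬Ax))

  finIndep-⊆ : {L : Subset U → Set} {G H : Subset U} → FinIndep L G → H ⊆ G → FinIndep L H
  finIndep-⊆ finG H⊆G T finT T⊆H = finG T finT (⊆-trans T⊆H H⊆G)

  ¬finIndep⇒dependent : {L : Subset U → Set} {G : Subset U} → ¬ FinIndep L G →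
                        ∃ λ T → Finite T × T ⊆ G × ¬ L T
  ¬finIndep⇒dependent ¬finG = dne₁ λ none → ¬finG λ T finT T⊆G → dne λ ¬LT → none (T , finT , T⊆G , ¬LT)

  Circuit : (Subset U → Set) → Subset U → Set
  Circuit L T = Finite T × ¬ L T × (∀ x → T x → L (T − x))

  DownClosed : (Subset U → Set) → Set₁
  DownClosed L = ∀ A B → L B → A ⊆ B → L A

  minimize : {L : Subset U → Set} → DownClosed L → (xs : List U) (T : Subset U) → ¬ L T →
             ∃ λ T′ → T′ ⊆ T × ¬ L T′ × (∀ x → x ∈ xs → T′ x → L (T′ − x))
  minimize I2 [] T ¬LT = T , (λ _ Tx → Tx) , ¬LT , λ _ ()
  minimize {L} I2 (x ∷ xs) T ¬LT with dec (L (T − x))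
  ... | no ¬L[T−x] with minimize I2 xs (T − x) ¬L[T−x]
  ...   | T′ , T′⊆ , ¬LT′ , minT′ = T′ , (λ z T′z → proj₁ (T′⊆ z T′z)) , ¬LT′ , minimal
    where
    minimal : ∀ z → z ∈ x ∷ xs → T′ z → L (T′ − z)
    minimal z (here refl) T′z = ⊥-elim (proj₂ (T′⊆ z T′z) refl)
    minimal z (there z∈) T′z = minT′ z z∈ T′z
  minimize {L} I2 (x ∷ xs) T ¬LT | yes L[T−x] with minimize I2 xs T ¬LT
  ... | T′ , T′⊆ , ¬LT′ , minT′ = T′ , T′⊆ , ¬LT′ , minimal
    where
    minimal : ∀ z → z ∈ x ∷ xs → T′ z → L (T′ − z)
    minimal z (here refl) T′z = I2 _ _ L[T−x] (λ y (T′y , y≢z) → T′⊆ y T′y , y≢z)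
    minimal z (there z∈) T′z = minT′ z z∈ T′z

  circuit-within : {L : Subset U → Set} {T : Subset U} → DownClosed L → Finite T → ¬ L T →
                   ∃ λ T′ → T′ ⊆ T × Circuit L T′
  circuit-within I2 (xs , cover) ¬LT with minimize I2 xs _ ¬LT
  ... | T′ , T′⊆T , ¬LT′ , minT′ =
    T′ , T′⊆T , (xs , λ x T′x → cover x (T′⊆T x T′x)) , ¬LT′ , λ x T′x → minT′ x (cover x (T′⊆T x T′x)) T′x

  circuit-through : {L : Subset U → Set} {F T : Subset U} {y : U} → FinIndep L F →
                    T ⊆ (F ∪ ｛ y ｝) → Finite T → ¬ L T → T y
  circuit-through finF T⊆ finT ¬LT = dne λ ¬Ty →
    ¬LT (finF _ finT λ x Tx → −⊆ T⊆ x (Tx , λ { refl → ¬Ty Tx }))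

  fundamental-circuit : {L : Subset U → Set} {F : Subset U} {y : U} → DownClosed L →
                        FinIndep L F → ¬ FinIndep L (F ∪ ｛ y ｝) →
                        ∃ λ T → T ⊆ (F ∪ ｛ y ｝) × Circuit L T × T y
  fundamental-circuit I2 finF ¬fin[F+y] with ¬finIndep⇒dependent ¬fin[F+y]
  ... | T₀ , finT₀ , T₀⊆ , ¬LT₀ with circuit-within I2 finT₀ ¬LT₀
  ... | T , T⊆T₀ , circ@(finT , ¬LT , _) =
    T , ⊆-trans T⊆T₀ T₀⊆ , circ , circuit-through finF (⊆-trans T⊆T₀ T₀⊆) finT ¬LT

  module MatroidFacts {E : Subset U} {L : Subset U → Set} (M : IsMatroid E L) where
    open IsMatroid M

    ∪⊆E : {A B : Subset U} → L A → L B → (A ∪ B) ⊆ E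
    ∪⊆E LA LB = ∪-lub (indep⊆E _ LA) (indep⊆E _ LB)

    finIndep⊆E : {G : Subset U} → FinIndep L G → G ⊆ E
    finIndep⊆E finG x Gx =
      indep⊆E ｛ x ｝ (finG ｛ x ｝ finite-｛｝ λ { _ refl → Gx }) x refl

    MaxIn : Subset U → Subset U → Set₁
    MaxIn X J = Maximal (λ S → L S × S ⊆ X) J

    maxIn-containing : {A X : Subset U} → L A → A ⊆ X → X ⊆ E → ∃ λ J → MaxIn X J × A ⊆ J
    maxIn-containing LA A⊆X X⊆E with I4 _ _ LA A⊆X X⊆E
    ... | J , (LJ , A⊆J , J⊆X) , maxJ =
      J , ((LJ , J⊆X) , λ C (LC , C⊆X) J⊆C → maxJ C (LC , ⊆-trans A⊆J J⊆C , C⊆X) J⊆C) , A⊆J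

    extendToBase : {A : Subset U} → L A → ∃ λ B → Maximal L B × A ⊆ B
    extendToBase LA with maxIn-containing LA (indep⊆E _ LA) (λ _ Ex → Ex)
    ... | B , maxB , A⊆B = B , maximal-resp (λ _ → proj₁) (λ C LC → LC , indep⊆E C LC) maxB , A⊆B

    maxIn-absorbs : {X J Q : Subset U} → MaxIn X J → L Q → J ⊆ Q → ∀ x → Q x → X x → J x
    maxIn-absorbs {X} {J} {Q} maxJ LQ J⊆Q x Qx Xx =
      proj₂ maxJ (λ y → Q y × X y) (I2 _ Q LQ (λ _ → proj₁) , λ _ → proj₂)
            (λ y Jy → J⊆Q y Jy , proj₂ (proj₁ maxJ) y Jy) x (Qx , Xx)

    baseBetween : {P I : Subset U} → Maximal L P → L I →
                  ∃ λ Q → Maximal L Q × I ⊆ Q × Q ⊆ (I ∪ P)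
    baseBetween maxP LI with maxIn-containing LI (λ _ → inj₁) (∪⊆E LI (proj₁ maxP))
    ... | Q , maxQ@((LQ , Q⊆) , _) , I⊆Q = Q , isBase , I⊆Q , Q⊆
      where
      isBase : Maximal L Q
      isBase = dne₁ λ ¬base → let (b , Pb , ¬Qb , L[Q+b]) = I3 Q _ maxP LQ ¬base in
        ¬Qb (proj₂ maxQ _ (L[Q+b] , ∪｛｝⊆ Q⊆ (inj₂ Pb)) (λ _ → inj₁) b (inj₂ refl))

    trapped : {X J A Z W : Subset U} → MaxIn X J → (∀ j → J j → ¬ A j → ¬ L (A ∪ ｛ j ｝)) →
              L Z → J ⊆ Z → L W → A ⊆ W → W ⊆ (A ∪ Z) → ∀ x → W x → X x → A x
    trapped {A = A} {Z} maxJ noAug LZ J⊆Z LW A⊆W W⊆ x Wx Xx = dne λ ¬Ax →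
      noAug x (maxIn-absorbs maxJ LZ J⊆Z x (inZ ¬Ax (W⊆ x Wx)) Xx) ¬Ax (I2 _ _ LW (∪｛｝⊆ A⊆W Wx))
      where
      inZ : ¬ A x → (A ∪ Z) x → Z x
      inZ ¬Ax (inj₁ Ax) = ⊥-elim (¬Ax Ax)
      inZ ¬Ax (inj₂ Zx) = Zx

    -- Matroids restrict: a maximal independent subset J of X augments every independent
    -- A that can be augmented by some c ∈ X.  (Axiom I3 for the restriction to X.)
    augmentWithin : {X J A : Subset U} {c : U} → MaxIn X J → L A → L (A ∪ ｛ c ｝) → X c → ¬ A c →
                    ∃ λ j → J j × ¬ A j × L (A ∪ ｛ j ｝)
    augmentWithin {X} {J} {A} {c} maxJ LA L[A+c] Xc ¬Ac =
      dne λ none → impossible (λ j Jj ¬Aj L[A+j] → none (j , Jj , ¬Aj , L[A+j]))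
      where
      LJ : L J
      LJ = proj₁ (proj₁ maxJ)
      J⊆X : J ⊆ X
      J⊆X = proj₂ (proj₁ maxJ)
      -- Choose bases J₁ ⊇ A inside A ∪ B₀ (for a base B₀ ⊇ J), C ⊇ A + c inside
      -- A + c ∪ J₁, Z ⊇ J inside J ∪ C and W ⊇ A inside A ∪ Z.  Then W ⊆ J₁ forces
      -- J₁ ⊆ W, but J₁ ⊄ C since c ∉ J₁, and a point of J₁ ∖ C cannot lie in W.
      impossible : (∀ j → J j → ¬ A j → ¬ L (A ∪ ｛ j ｝)) → ⊥
      impossible noAug with extendToBase LJ
      ... | B₀ , maxB₀ , J⊆B₀ with baseBetween maxB₀ LA
      ... | J₁ , maxJ₁ , A⊆J₁ , J₁⊆ with baseBetween maxJ₁ L[A+c]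
      ... | C , maxC , A+c⊆C , C⊆ with baseBetween maxC LJ
      ... | Z , maxZ , J⊆Z , Z⊆ with baseBetween maxZ LA
      ... | W , maxW , A⊆W , W⊆ = outsideW (¬⊆⇒witness J₁⊄C)
        where
        J₁∩X⊆A : ∀ x → J₁ x → X x → A x
        J₁∩X⊆A = trapped maxJ noAug (proj₁ maxB₀) J⊆B₀ (proj₁ maxJ₁) A⊆J₁ J₁⊆
        J₁⊄C : ¬ (J₁ ⊆ C)
        J₁⊄C J₁⊆C = ¬Ac (J₁∩X⊆A c (proj₂ maxJ₁ C (proj₁ maxC) J₁⊆C c (A+c⊆C c (inj₂ refl))) Xc)
        A⊆C : A ⊆ C
        A⊆C x Ax = A+c⊆C x (inj₁ Ax)
        W∩X⊆A : ∀ x → W x → X x → A x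
        W∩X⊆A = trapped maxJ noAug (proj₁ maxZ) J⊆Z (proj₁ maxW) A⊆W W⊆
        -- Outside A, W avoids X, so its points come from C ∖ {c} ⊆ J₁.
        W⊆J₁ : W ⊆ J₁
        W⊆J₁ x Wx with W⊆ x Wx
        ... | inj₁ Ax = A⊆J₁ x Ax
        ... | inj₂ Zx with Z⊆ x Zx
        ...   | inj₁ Jx = A⊆J₁ x (W∩X⊆A x Wx (J⊆X x Jx))
        ...   | inj₂ Cx with C⊆ x Cx
        ...     | inj₂ J₁x = J₁x
        ...     | inj₁ (inj₁ Ax) = A⊆J₁ x Ax
        ...     | inj₁ (inj₂ refl) = ⊥-elim (¬Ac (W∩X⊆A x Wx Xc))
        outsideW : (∃ λ d → J₁ d × ¬ C d) → ⊥
        outsideW (d , J₁d , ¬Cd) = ¬Wd (proj₂ maxW J₁ (proj₁ maxJ₁) W⊆J₁ d J₁d)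
          where
          ¬Ad : ¬ A d
          ¬Ad Ad = ¬Cd (A⊆C d Ad)
          ¬Wd : ¬ W d
          ¬Wd Wd with W⊆ d Wd
          ... | inj₁ Ad = ¬Ad Ad
          ... | inj₂ Zd with Z⊆ d Zd
          ...   | inj₁ Jd = ¬Ad (J₁∩X⊆A d J₁d (J⊆X d Jd))
          ...   | inj₂ Cd = ¬Cd Cd

    circuitElimination : {C₁ C₂ : Subset U} {g e : U} → C₁ ⊆ E → C₂ ⊆ E → C₁ g → ¬ C₂ g →
                         ¬ g ≡ e → L (C₁ − g) → ¬ L C₁ → ¬ L C₂ → ¬ L ((C₁ ∪ C₂) − e)
    circuitElimination {C₁} {C₂} {g} {e} C₁⊆E C₂⊆E C₁g ¬C₂g g≢e L[C₁−g] ¬LC₁ ¬LC₂ LK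
      with maxIn-containing L[C₁−g] (λ x C₁−g∋x → inj₁ (proj₁ C₁−g∋x)) (∪-lub C₁⊆E C₂⊆E)
    ... | J , maxJ , C₁−g⊆J = augmentedByE (augmentWithin maxJ LA LA+g (inj₁ C₁g) (λ Ag → proj₂ Ag refl))
      where
      -- J ⊇ C₁ − g is maximal in C₁ ∪ C₂, so it misses g; it must augment A by e.
      A : Subset U
      A = ((C₁ ∪ C₂) − e) − g
      LA : L A
      LA = I2 A _ LK (λ _ → proj₁)
      LA+g : L (A ∪ ｛ g ｝)
      LA+g = I2 _ _ LK (∪｛｝⊆ (λ _ → proj₁) (inj₁ C₁g , g≢e))
      ¬Jg : ¬ J g
      ¬Jg Jg = ¬LC₁ (I2 C₁ J (proj₁ (proj₁ maxJ)) C₁⊆J)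
        where
        C₁⊆J : C₁ ⊆ J
        C₁⊆J x C₁x with dec (x ≡ g)
        ... | yes refl = Jg
        ... | no x≢g = C₁−g⊆J x (C₁x , x≢g)
      augmentedByE : (∃ λ j → J j × ¬ A j × L (A ∪ ｛ j ｝)) → ⊥
      augmentedByE (j , Jj , ¬Aj , L[A+j]) = ¬LC₂ (I2 C₂ _ L[A+j] C₂⊆A+j)
        where
        j≡e : j ≡ e
        j≡e = dne λ j≢e → ¬Aj ((proj₂ (proj₁ maxJ) j Jj , j≢e) , λ { refl → ¬Jg Jj })
        C₂⊆A+j : C₂ ⊆ (A ∪ ｛ j ｝)
        C₂⊆A+j x C₂x with dec (x ≡ e)
        ... | yes x≡e = inj₂ (trans x≡e (sym j≡e))
        ... | no x≢e = inj₁ ((inj₂ C₂x , x≢e) , λ { refl → ¬C₂g C₂x })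

    FinBaseExcept : U → Subset U → Set₁
    FinBaseExcept y F = FinIndep L F × (∀ x → ¬ F x → ¬ x ≡ y → ¬ FinIndep L (F ∪ ｛ x ｝))

    finBase⇒finBaseExcept : {F : Subset U} {y : U} → Maximal (FinIndep L) F → FinBaseExcept y F
    finBase⇒finBaseExcept maxF = proj₁ maxF , λ x ¬Fx _ → maximal-cannot-grow maxF ¬Fx

    finBaseExcept-with : {F : Subset U} {y : U} → FinBaseExcept y F → FinIndep L (F ∪ ｛ y ｝) →
                         Maximal (FinIndep L) (F ∪ ｛ y ｝)
    finBaseExcept-with {F} {y} (_ , onlyY) fin[F+y] = fin[F+y] , maximal
      where
      maximal : ∀ C → FinIndep L C → (F ∪ ｛ y ｝) ⊆ C → C ⊆ (F ∪ ｛ y ｝)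
      maximal C finC F+y⊆C x Cx = dne λ ¬[F+y]x →
        onlyY x (λ Fx → ¬[F+y]x (inj₁ Fx)) (λ x≡y → ¬[F+y]x (inj₂ x≡y))
              (finIndep-⊆ finC (∪｛｝⊆ (λ z Fz → F+y⊆C z (inj₁ Fz)) Cx))

    finBaseExcept-without : {F : Subset U} {y : U} → FinBaseExcept y F → ¬ FinIndep L (F ∪ ｛ y ｝) →
                            Maximal (FinIndep L) F
    finBaseExcept-without {F} {y} (finF , onlyY) ¬fin[F+y] = finF , maximal
      where
      maximal : ∀ C → FinIndep L C → F ⊆ C → C ⊆ F
      maximal C finC F⊆C x Cx = dne λ ¬Fx → cannotGrow x ¬Fx (dec (x ≡ y))
                                  (finIndep-⊆ finC (∪｛｝⊆ F⊆C Cx))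
        where
        cannotGrow : ∀ x → ¬ F x → Dec (x ≡ y) → ¬ FinIndep L (F ∪ ｛ x ｝)
        cannotGrow x ¬Fx (yes refl) = ¬fin[F+y]
        cannotGrow x ¬Fx (no x≢y) = onlyY x ¬Fx x≢y

    -- Both independence and
    -- maximality reduce to circuit elimination against T.
    finExchange : {F T : Subset U} {y f : U} → FinBaseExcept y F → E y → T ⊆ (F ∪ ｛ y ｝) →
                  Circuit L T → T f → ¬ f ≡ y → Maximal (FinIndep L) ((F ∪ ｛ y ｝) − f)
    finExchange {F} {T} {y} {f} (finF , onlyY) Ey T⊆ (finT , ¬LT , minT) Tf f≢y = independent , maximal
      where
      F′ : Subset U
      F′ = (F ∪ ｛ y ｝) − f
      F+y⊆E : (F ∪ ｛ y ｝) ⊆ E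
      F+y⊆E = ∪｛｝⊆ (finIndep⊆E finF) Ey
      Ty : T y
      Ty = circuit-through finF T⊆ finT ¬LT
      ¬Fy : ¬ F y
      ¬Fy Fy = ¬LT (finF T finT (⊆-trans T⊆ (∪｛｝⊆ (λ _ Fx → Fx) Fy)))
      -- A finite dependent T₂ ⊆ F′ would leave (T ∪ T₂) − y ⊆ F dependent.
      independent : FinIndep L F′
      independent T₂ finT₂ T₂⊆F′ = dne λ ¬LT₂ →
        circuitElimination (⊆-trans T⊆ F+y⊆E) (⊆-trans T₂⊆F+y F+y⊆E) Tf (λ T₂f → proj₂ (T₂⊆F′ f T₂f) refl)
                           f≢y (minT f Tf) ¬LT ¬LT₂
                           (finF _ (finite-⊆ (λ _ → proj₁) (finite-∪ finT finT₂)) (−⊆ (∪-lub T⊆ T₂⊆F+y)))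
        where
        T₂⊆F+y : T₂ ⊆ (F ∪ ｛ y ｝)
        T₂⊆F+y x T₂x = proj₁ (T₂⊆F′ x T₂x)
      -- A point x ∉ F′ of a finitarily independent C ⊇ F′ is either f, and then T ⊆ C,
      -- or it closes a finite dependent T₃ ⊆ F ∪ {x} avoiding y, and then (T ∪ T₃) − f ⊆ C.
      maximal : ∀ C → FinIndep L C → F′ ⊆ C → C ⊆ F′
      maximal C finC F′⊆C x Cx = dne λ ¬F′x → newPoint ¬F′x (dec (x ≡ f))
        where
        F+y⊆C+f : (F ∪ ｛ y ｝) ⊆ (C ∪ ｛ f ｝)
        F+y⊆C+f z F+y∋z with dec (z ≡ f)
        ... | yes z≡f = inj₂ z≡f
        ... | no z≢f = inj₁ (F′⊆C z (F+y∋z , z≢f))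
        newPoint : ¬ F′ x → Dec (x ≡ f) → ⊥
        newPoint ¬F′x (yes refl) = ¬LT (finC T finT (⊆-trans T⊆ (⊆-trans F+y⊆C+f (∪｛｝⊆ (λ _ Cz → Cz) Cx))))
        newPoint ¬F′x (no x≢f) with ¬finIndep⇒dependent (onlyY x (λ Fx → ¬F′x (inj₁ Fx , x≢f))
                                                                 (λ { refl → ¬F′x (inj₂ refl , x≢f) }))
        ... | T₃ , finT₃ , T₃⊆ , ¬LT₃ =
          circuitElimination (⊆-trans T⊆ F+y⊆E) (⊆-trans T₃⊆ (∪｛｝⊆ (finIndep⊆E finF) (finIndep⊆E finC x Cx)))
                             Ty ¬T₃y (λ y≡f → f≢y (sym y≡f)) (minT y Ty) ¬LT ¬LT₃
                             (finC _ (finite-⊆ (λ _ → proj₁) (finite-∪ finT finT₃)) K⊆C)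
          where
          ¬T₃y : ¬ T₃ y
          ¬T₃y T₃y = [ ¬Fy , (λ y≡x → ¬F′x (inj₂ (sym y≡x) , x≢f)) ] (T₃⊆ y T₃y)
          K⊆C : ((T ∪ T₃) − f) ⊆ C
          K⊆C z (inj₁ Tz , z≢f) = F′⊆C z (T⊆ z Tz , z≢f)
          K⊆C z (inj₂ T₃z , z≢f) with T₃⊆ z T₃z
          ... | inj₁ Fz = F′⊆C z (inj₁ Fz , z≢f)
          ... | inj₂ refl = Cx

    absorb : {F I : Subset U} {y : U} → FinBaseExcept y F → L I → I ⊆ (F ∪ ｛ y ｝) →
             ∃ λ F* → ∃ λ g → Maximal (FinIndep L) F* × I ⊆ F* × F ⊆ (F* ∪ ｛ g ｝)
    absorb {F} {I} {y} except LI I⊆ with em {FinIndep L (F ∪ ｛ y ｝)}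
    ... | yes fin[F+y] = F ∪ ｛ y ｝ , y , finBaseExcept-with except fin[F+y] , I⊆ , λ x Fx → inj₁ (inj₁ Fx)
    ... | no ¬fin[F+y] with dec (I y)
    ...   | no ¬Iy = F , y , finBaseExcept-without except ¬fin[F+y] , I⊆F , λ x Fx → inj₁ Fx
      where
      I⊆F : I ⊆ F
      I⊆F x Ix = −⊆ I⊆ x (Ix , λ { refl → ¬Iy Ix })
    ...   | yes Iy with fundamental-circuit I2 (proj₁ except) ¬fin[F+y]
    ...     | T , T⊆ , circ@(_ , ¬LT , _) , _ with ¬⊆⇒witness (λ T⊆I → ¬LT (I2 T I LI T⊆I))
    ...       | f , Tf , ¬If = (F ∪ ｛ y ｝) − f , f ,
                             finExchange except (indep⊆E I LI y Iy) T⊆ circ Tf (λ { refl → ¬If Iy }) ,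
                             (λ x Ix → I⊆ x Ix , λ { refl → ¬If Ix }) , F⊆F*+f
      where
      F⊆F*+f : F ⊆ (((F ∪ ｛ y ｝) − f) ∪ ｛ f ｝)
      F⊆F*+f x Fx with dec (x ≡ f)
      ... | yes x≡f = inj₂ x≡f
      ... | no x≢f = inj₁ (inj₁ Fx , x≢f)

    baseExchange : {B : Subset U} {s y : U} → Maximal L B → ¬ B y → L ((B − s) ∪ ｛ y ｝) →
                   Maximal L ((B − s) ∪ ｛ y ｝)
    baseExchange {B} {s} {y} maxB ¬By LB′ = dne₁ λ ¬base →
      let (b , Bb , ¬B′b , L[B′+b]) = I3 _ B maxB LB′ ¬base in
      maximal-cannot-grow maxB ¬By (I2 _ _ L[B′+b] (B+y⊆B′+b Bb ¬B′b))
      where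
      -- The only point of B outside B′ = (B − s) ∪ {y} is s, so B′ + b ⊇ B ∪ {y}.
      B+y⊆B′+b : {b : U} → B b → ¬ ((B − s) ∪ ｛ y ｝) b → (B ∪ ｛ y ｝) ⊆ (((B − s) ∪ ｛ y ｝) ∪ ｛ b ｝)
      B+y⊆B′+b Bb ¬B′b x (inj₂ x≡y) = inj₁ (inj₂ x≡y)
      B+y⊆B′+b Bb ¬B′b x (inj₁ Bx) with dec (x ≡ s)
      ... | no x≢s = inj₁ (inj₁ (Bx , x≢s))
      ... | yes refl = inj₂ (dne λ x≢b → ¬B′b (inj₁ (Bb , λ b≡x → x≢b (sym b≡x))))

    deletionBase⇒maxIn : {S B : Subset U} → Maximal (DelIndep L S) B → MaxIn (E ∖ S) B
    deletionBase⇒maxIn maxB = maximal-resp (λ D (LD , avoidD) → LD , λ x Dx → indep⊆E D LD x Dx , avoidD x Dx)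
                                           (λ D (LD , D⊆) → LD , λ x Dx → proj₂ (D⊆ x Dx)) maxB

    -- Deletion M − S is a matroid; its augmentation axiom is augmentation within E ∖ S.
    deletionIsMatroid : (S : Subset U) → IsMatroid (E ∖ S) (DelIndep L S)
    deletionIsMatroid S = record
      { indep⊆E = λ A (LA , avoidA) x Ax → indep⊆E A LA x Ax , avoidA x Ax
      ; I1 = I1 , λ _ ()
      ; I2 = λ A B (LB , avoidB) A⊆B → I2 A B LB A⊆B , ⊆-trans A⊆B avoidB
      ; I3 = augment
      ; I4 = maximize
      }
      where
      augment : ∀ A B → Maximal (DelIndep L S) B → DelIndep L S A → ¬ Maximal (DelIndep L S) A →
                ∃ λ b → B b × ¬ A b × DelIndep L S (A ∪ ｛ b ｝)
      augment A B maxB (LA , avoidA) ¬maxA =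
        let (C , (LC , avoidC) , A⊆C , c , Cc , ¬Ac) = not-maximal⇒larger (LA , avoidA) ¬maxA
            (b , Bb , ¬Ab , L[A+b]) = augmentWithin (deletionBase⇒maxIn maxB) LA (I2 _ C LC (∪｛｝⊆ A⊆C Cc))
                                                    (indep⊆E C LC c Cc , avoidC c Cc) ¬Ac
        in b , Bb , ¬Ab , L[A+b] , ∪｛｝⊆ avoidA (proj₂ (proj₁ maxB) b Bb)
      maximize : ∀ A X → DelIndep L S A → A ⊆ X → X ⊆ (E ∖ S) →
                 ∃ λ J → Maximal (λ J → DelIndep L S J × A ⊆ J × J ⊆ X) J
      maximize A X (LA , _) A⊆X X⊆ =
        let (J , (LJ , A⊆J , J⊆X) , maxJ) = I4 A X LA A⊆X (λ x Xx → proj₁ (X⊆ x Xx))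
        in J , ((LJ , λ x Jx → proj₂ (X⊆ x (J⊆X x Jx))) , A⊆J , J⊆X) ,
           λ C ((LC , _) , A⊆C , C⊆X) J⊆C → maxJ C (LC , A⊆C , C⊆X) J⊆C

    module DeleteElement (s : U) where

      L′ : Subset U → Set
      L′ = DelIndep L ｛ s ｝

      finIndep-forget : {G : Subset U} → FinIndep L′ G → FinIndep L G
      finIndep-forget finG T finT T⊆G = proj₁ (finG T finT T⊆G)

      finIndep-avoids : {G : Subset U} → FinIndep L′ G → ∀ x → G x → ¬ x ≡ s
      finIndep-avoids finG x Gx = proj₂ (finG ｛ x ｝ finite-｛｝ λ { _ refl → Gx }) x refl

      finIndep-delete : {G : Subset U} → FinIndep L G → (∀ x → G x → ¬ x ≡ s) → FinIndep L′ G
      finIndep-delete finG avoidG T finT T⊆G = finG T finT T⊆G , λ x Tx → avoidG x (T⊆G x Tx)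

      finBase-deletion : {F : Subset U} → Maximal (FinIndep L′) F → FinBaseExcept s F
      finBase-deletion maxF = finIndep-forget (proj₁ maxF) , λ x ¬Fx x≢s fin[F+x] →
        maximal-cannot-grow maxF ¬Fx (finIndep-delete fin[F+x] (∪｛｝⊆ (finIndep-avoids (proj₁ maxF)) x≢s))

      overDeletionBase : {B′ B : Subset U} → Maximal L′ B′ → L B → B′ ⊆ B → B ⊆ (B′ ∪ ｛ s ｝)
      overDeletionBase maxB′ LB B′⊆B x Bx with dec (x ≡ s)
      ... | yes x≡s = inj₂ x≡s
      ... | no x≢s = inj₁ (proj₂ maxB′ (_ − s) (I2 _ _ LB (λ _ → proj₁) , λ _ → proj₂)
                                       (λ z B′z → B′⊆B z B′z , proj₂ (proj₁ maxB′) z B′z) x (Bx , x≢s))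

      -- M − s is nearly finitary when M is: given a finitary base F′ ⊇ B′ of M − s, absorb
      -- a base B ⊇ B′ of M (which lies in F′ ∪ {s}) into a finitary base F of M.
      nearlyFinitary-deletion : NearlyFinitary L → NearlyFinitary L′
      nearlyFinitary-deletion nf F′ B′ maxF′ maxB′ B′⊆F′ with extendToBase (proj₁ (proj₁ maxB′))
      ... | B , maxB , B′⊆B with absorb (finBase-deletion maxF′) (proj₁ maxB) (⊆-trans B⊆B′+s (∪-mono B′⊆F′))
        where
        B⊆B′+s : B ⊆ (B′ ∪ ｛ s ｝)
        B⊆B′+s = overDeletionBase maxB′ (proj₁ maxB) B′⊆B
      ... | F , g , maxF , B⊆F , F′⊆F+g = finite-⊆ cover (finite-∪｛｝ (nf F B maxF maxB B⊆F))
        where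
        cover : (F′ ∖ B′) ⊆ ((F ∖ B) ∪ ｛ g ｝)
        cover x (F′x , ¬B′x) with F′⊆F+g x F′x
        ... | inj₂ x≡g = inj₂ x≡g
        ... | inj₁ Fx = inj₁ (Fx , λ Bx → [ ¬B′x , finIndep-avoids (proj₁ maxF′) x F′x ]
                                             (overDeletionBase maxB′ (proj₁ maxB) B′⊆B x Bx))

      deletionBase : {B : Subset U} → Maximal L B → ∃ λ B₁ → ∃ λ y → Maximal L′ B₁ × B₁ ⊆ (B ∪ ｛ y ｝)
      deletionBase {B} maxB with dec (∃ λ y → ¬ (B − s) y × ¬ y ≡ s × L ((B − s) ∪ ｛ y ｝))
      ... | no cannotGrow = B − s , s , (L′[B−s] , maximal) , λ x (Bx , _) → inj₁ Bx
        where
        L′[B−s] : L′ (B − s)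
        L′[B−s] = I2 _ B (proj₁ maxB) (λ _ → proj₁) , λ _ → proj₂
        maximal : ∀ C → L′ C → (B − s) ⊆ C → C ⊆ (B − s)
        maximal C (LC , avoidC) B−s⊆C x Cx = dne λ ¬[B−s]x →
          cannotGrow (x , ¬[B−s]x , avoidC x Cx , I2 _ C LC (∪｛｝⊆ B−s⊆C Cx))
      ... | yes (y , ¬[B−s]y , y≢s , LB′) =
        (B − s) ∪ ｛ y ｝ , y ,
        maximal-restrict (λ _ → proj₁) (LB′ , ∪｛｝⊆ (λ _ → proj₂) y≢s)
                         (baseExchange maxB (λ By → ¬[B−s]y (By , y≢s)) LB′) ,
        ∪-mono (λ _ → proj₁)

      -- Every finitary base F of M contains F − s inside some finitary base of M − s:
      -- F − s itself, or (F ∪ {z}) − s obtained by exchanging s for a new point z.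
      restrictFinBase : {F : Subset U} → Maximal (FinIndep L) F →
                        ∃ λ F₁ → Maximal (FinIndep L′) F₁ × (F − s) ⊆ F₁
      restrictFinBase {F} maxF with em {∃ λ z → ¬ (F − s) z × ¬ z ≡ s × FinIndep L ((F − s) ∪ ｛ z ｝)}
      ... | no cannotGrow = F − s , (fin[F−s] , maximal) , λ _ F−s∋x → F−s∋x
        where
        fin[F−s] : FinIndep L′ (F − s)
        fin[F−s] = finIndep-delete (finIndep-⊆ (proj₁ maxF) (λ _ → proj₁)) (λ _ → proj₂)
        maximal : ∀ C → FinIndep L′ C → (F − s) ⊆ C → C ⊆ (F − s)
        maximal C finC F−s⊆C x Cx = dne λ ¬[F−s]x →
          cannotGrow (x , ¬[F−s]x , finIndep-avoids finC x Cx ,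
                      finIndep-⊆ (finIndep-forget finC) (∪｛｝⊆ F−s⊆C Cx))
      ... | yes (z , ¬[F−s]z , z≢s , fin[F−s+z]) with fundamental-circuit I2 (proj₁ maxF) (maximal-cannot-grow maxF ¬Fz)
        where
        ¬Fz : ¬ F z
        ¬Fz Fz = ¬[F−s]z (Fz , z≢s)
      ... | T , T⊆ , circ@(finT , ¬LT , _) , _ =
        (F ∪ ｛ z ｝) − s ,
        maximal-restrict (λ _ → finIndep-forget) (finIndep-delete (proj₁ exchanged) (λ _ → proj₂)) exchanged ,
        λ x (Fx , x≢s) → inj₁ Fx , x≢s
        where
        -- T cannot avoid s, since (F − s) ∪ {z} is finitarily independent.
        Ts : T s
        Ts = dne λ ¬Ts → ¬LT (fin[F−s+z] T finT λ x Tx →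
               [ (λ Fx → inj₁ (Fx , λ { refl → ¬Ts Tx })) , inj₂ ] (T⊆ x Tx))
        exchanged : Maximal (FinIndep L) ((F ∪ ｛ z ｝) − s)
        exchanged = finExchange (finBase⇒finBaseExcept maxF) (finIndep⊆E fin[F−s+z] z (inj₂ refl))
                                T⊆ circ Ts (λ s≡z → z≢s (sym s≡z))

      -- If M − s is n-nearly finitary then M is (3 + n)-nearly finitary: from bases
      -- B ⊆ F of M and M^fin pass to a base B₁ ⊆ B ∪ {y} of M − s, absorb it into a
      -- finitary base F* ⊇ F − g of M and restrict to a finitary base F₁ ⊇ F* − s of M − s.
      nNearlyFinitary-deletion : (n : ℕ) → NNearlyFinitary n L′ → NNearlyFinitary (3 + n) L
      nNearlyFinitary-deletion n nnf F B maxF maxB B⊆F with deletionBase maxB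
      ... | B₁ , y , maxB₁ , B₁⊆B+y
        with absorb (finBase⇒finBaseExcept maxF) (proj₁ (proj₁ maxB₁)) (⊆-trans B₁⊆B+y (∪-mono B⊆F))
      ... | F* , g , maxF* , B₁⊆F* , F⊆F*+g with restrictFinBase maxF*
      ... | F₁ , maxF₁ , F*−s⊆F₁ =
        atMost-⊆ cover (atMost-∪｛｝ (atMost-∪｛｝ (atMost-∪｛｝ (nnf F₁ B₁ maxF₁ maxB₁ B₁⊆F₁))))
        where
        B₁⊆F₁ : B₁ ⊆ F₁
        B₁⊆F₁ x B₁x = F*−s⊆F₁ x (B₁⊆F* x B₁x , proj₂ (proj₁ maxB₁) x B₁x)
        cover : (F ∖ B) ⊆ ((((F₁ ∖ B₁) ∪ ｛ g ｝) ∪ ｛ s ｝) ∪ ｛ y ｝)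
        cover x (Fx , ¬Bx) with dec (x ≡ y) | dec (x ≡ s) | F⊆F*+g x Fx
        ... | yes x≡y | _ | _ = inj₂ x≡y
        ... | no _ | yes x≡s | _ = inj₁ (inj₂ x≡s)
        ... | no _ | no _ | inj₂ x≡g = inj₁ (inj₁ (inj₂ x≡g))
        ... | no x≢y | no x≢s | inj₁ F*x =
          inj₁ (inj₁ (inj₁ (F*−s⊆F₁ x (F*x , x≢s) , λ B₁x → [ ¬Bx , x≢y ] (B₁⊆B+y x B₁x))))

  record UnboundedNearlyFinitary (E : Subset U) (L : Subset U → Set) : Set₁ where
    field
      matroid : IsMatroid E L
      nearlyFinitary : NearlyFinitary L
      unbounded : ∀ n → ¬ NNearlyFinitary n L

  deleteOne : {E : Subset U} {L : Subset U → Set} → UnboundedNearlyFinitary E L → (s : U) →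
              UnboundedNearlyFinitary (E ∖ ｛ s ｝) (DelIndep L ｛ s ｝)
  deleteOne M s = record
    { matroid = deletionIsMatroid ｛ s ｝
    ; nearlyFinitary = nearlyFinitary-deletion (nearlyFinitary M)
    ; unbounded = λ n nnf → unbounded M (3 + n) (nNearlyFinitary-deletion n nnf)
    }
    where
    open UnboundedNearlyFinitary
    open MatroidFacts (matroid M)
    open DeleteElement s

  _≐_ : Subset U → Subset U → Set
  A ≐ B = A ⊆ B × B ⊆ A

  _≋_ : (Subset U → Set) → (Subset U → Set) → Set₁
  L₁ ≋ L₂ = (∀ A → L₁ A → L₂ A) × (∀ A → L₂ A → L₁ A)

  ≋-sym : {L₁ L₂ : Subset U → Set} → L₁ ≋ L₂ → L₂ ≋ L₁
  ≋-sym (to , from) = from , to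

  finIndep-map : {L₁ L₂ : Subset U → Set} → (∀ A → L₁ A → L₂ A) → ∀ G → FinIndep L₁ G → FinIndep L₂ G
  finIndep-map to G finG T finT T⊆G = to T (finG T finT T⊆G)

  nearlyFinitary-resp : {L₁ L₂ : Subset U → Set} → L₁ ≋ L₂ → NearlyFinitary L₁ → NearlyFinitary L₂
  nearlyFinitary-resp (to , from) nf F B maxF maxB B⊆F =
    nf F B (maximal-resp (finIndep-map from) (finIndep-map to) maxF) (maximal-resp from to maxB) B⊆F

  nNearlyFinitary-resp : {L₁ L₂ : Subset U → Set} {n : ℕ} → L₁ ≋ L₂ →
                         NNearlyFinitary n L₁ → NNearlyFinitary n L₂
  nNearlyFinitary-resp (to , from) nnf F B maxF maxB B⊆F =
    nnf F B (maximal-resp (finIndep-map from) (finIndep-map to) maxF) (maximal-resp from to maxB) B⊆F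

  unboundedNearlyFinitary-resp : {E₁ E₂ : Subset U} {L₁ L₂ : Subset U → Set} → E₁ ≐ E₂ → L₁ ≋ L₂ →
                                 UnboundedNearlyFinitary E₁ L₁ → UnboundedNearlyFinitary E₂ L₂
  unboundedNearlyFinitary-resp (E₁⊆E₂ , E₂⊆E₁) L₁≋L₂@(to , from) M = record
    { matroid = record
      { indep⊆E = λ A L₂A → ⊆-trans (indep⊆E A (from A L₂A)) E₁⊆E₂
      ; I1 = to _ I1
      ; I2 = λ A B L₂B A⊆B → to A (I2 A B (from B L₂B) A⊆B)
      ; I3 = λ A B maxB L₂A ¬maxA →
          let (b , Bb , ¬Ab , L₁[A+b]) = I3 A B (maximal-resp from to maxB) (from A L₂A)
                                            (λ maxA → ¬maxA (maximal-resp to from maxA))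
          in b , Bb , ¬Ab , to _ L₁[A+b]
      ; I4 = λ A X L₂A A⊆X X⊆E₂ →
          let (J , maxJ) = I4 A X (from A L₂A) A⊆X (⊆-trans X⊆E₂ E₂⊆E₁)
          in J , maximal-resp (λ C (LC , bounds) → to C LC , bounds) (λ C (LC , bounds) → from C LC , bounds) maxJ
      }
    ; nearlyFinitary = nearlyFinitary-resp L₁≋L₂ nearlyFinitary
    ; unbounded = λ n nnf → unbounded n (nNearlyFinitary-resp (≋-sym L₁≋L₂) nnf)
    }
    where
    open UnboundedNearlyFinitary M
    open IsMatroid matroid

  deleteListed : (xs : List U) {E : Subset U} {L : Subset U → Set} {S : Subset U} →
                 UnboundedNearlyFinitary E L → S ≐ (_∈ xs) →
                 UnboundedNearlyFinitary (E ∖ S) (DelIndep L S)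
  deleteListed [] M (S⊆ , _) =
    unboundedNearlyFinitary-resp ((λ x Ex → Ex , λ Sx → nothingListed (S⊆ x Sx)) , λ _ → proj₁)
                                 ((λ A LA → LA , λ x _ Sx → nothingListed (S⊆ x Sx)) , λ _ → proj₁) M
    where
    nothingListed : {x : U} → ¬ x ∈ []
    nothingListed ()
  deleteListed (x ∷ xs) {E} {L} {S} M (S⊆ , ⊆S) =
    unboundedNearlyFinitary-resp (ground₁ , ground₂) (indep₁ , indep₂)
                                 (deleteListed xs (deleteOne M x) ((λ _ y∈ → y∈) , λ _ y∈ → y∈))
    where
    inS : ∀ y → S y → y ≡ x ⊎ y ∈ xs
    inS y Sy with S⊆ y Sy
    ... | here y≡x = inj₁ y≡x
    ... | there y∈xs = inj₂ y∈xs
    ground₁ : ((E ∖ ｛ x ｝) ∖ (_∈ xs)) ⊆ (E ∖ S)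
    ground₁ y ((Ey , y≢x) , y∉xs) = Ey , λ Sy → [ y≢x , y∉xs ] (inS y Sy)
    ground₂ : (E ∖ S) ⊆ ((E ∖ ｛ x ｝) ∖ (_∈ xs))
    ground₂ y (Ey , ¬Sy) = (Ey , λ y≡x → ¬Sy (⊆S y (here y≡x))) , λ y∈xs → ¬Sy (⊆S y (there y∈xs))
    indep₁ : ∀ A → DelIndep (DelIndep L ｛ x ｝) (_∈ xs) A → DelIndep L S A
    indep₁ A ((LA , avoidX) , avoidXs) = LA , λ y Ay Sy → [ avoidX y Ay , avoidXs y Ay ] (inS y Sy)
    indep₂ : ∀ A → DelIndep L S A → DelIndep (DelIndep L ｛ x ｝) (_∈ xs) A
    indep₂ A (LA , avoidS) =
      (LA , λ y Ay y≡x → avoidS y Ay (⊆S y (here y≡x))) , λ y Ay y∈xs → avoidS y Ay (⊆S y (there y∈xs))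

theorem3p4p7 : ExcludedMiddle (suc 0ℓ) →
    {U : Set} (E : Subset U) (L : Subset U → Set) →
    IsMatroid E L → NearlyFinitary L → (∀ (n : ℕ) → ¬ NNearlyFinitary n L) →
    (S : Subset U) → S ⊆ E → Finite S →
    IsMatroid (DelGround E S) (DelIndep L S) ×
    NearlyFinitary (DelIndep L S) ×
    (∀ (n : ℕ) → ¬ NNearlyFinitary n (DelIndep L S))
theorem3p4p7 em E L matroid nf unbounded S _ finS =
  UnboundedNearlyFinitary.matroid M−S , UnboundedNearlyFinitary.nearlyFinitary M−S ,
  UnboundedNearlyFinitary.unbounded M−S
  where
  open Classical em
  M−S : UnboundedNearlyFinitary (E ∖ S) (DelIndep L S)
  M−S = let (xs , S⊆xs , xs⊆S) = listing finS in
        deleteListed xs (record { matroid = matroid ; nearlyFinitary = nf ; unbounded = unbounded })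
                     (S⊆xs , xs⊆S)
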